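{- Fix an integer $m\ge 2$ and let $M=(m_{ij})$ be an $m\times 2$ matrix with integer entries. Let $q$ be a non-zero integer such that $q$ divides all $m(m-1)/2$ minors of size $2\times 2$ of $M$, and assume that there is no prime $p\mid q$ dividing all the entries of $M$. Then \[ \Lambda_q=\{\mathbf{v}\in\mathbb{Z}^2:\ q\mid M\mathbf{v}\} \] (where $q\mid M\mathbf{v}$ means $q$ divides every coordinate of $M\mathbf{v}$) is a lattice of determinant $|q|$, i.e. $[\mathbb{Z}^2:\Lambda_q]=|q|$. -}

module Defs where

open import Data.Nat using (ℕ)
open import Data.Fin using (Fin; zero; suc)
open import Data.Integer using (ℤ; _+_; _*_; _-_)
open import Data.Integer.Divisibility using (_∣_)
open import Data.Product using (∃)
open import Relation.Binary.PropositionalEquality using (_≡_)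

Mat : ℕ → ℕ → Set
Mat r c = Fin r → Fin c → ℤ

Vec2 : Set
Vec2 = Fin 2 → ℤ

c₀ c₁ : Fin 2
c₀ = zero
c₁ = suc zero

minor : ∀ {m} → Mat m 2 → Fin m → Fin m → ℤ
minor M i j = M i c₀ * M j c₁ - M i c₁ * M j c₀

mulVec : ∀ {m} → Mat m 2 → Vec2 → Fin m → ℤ
mulVec M v i = M i c₀ * v c₀ + M i c₁ * v c₁

InΛ : ∀ {m} → Mat m 2 → ℤ → Vec2 → Set
InΛ M q v = ∀ i → q ∣ mulVec M v i

det2 : Mat 2 2 → ℤ
det2 B = B c₀ c₀ * B c₁ c₁ - B c₀ c₁ * B c₁ c₀

InSpan : Mat 2 2 → Vec2 → Set
InSpan B v = ∃ λ (c : Vec2) → ∀ k → v k ≡ mulVec B c k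

{-# OPTIONS --safe #-}
module Submission where

-- Let d be the gcd of q and the second column of M, so that q = q′ d and M i c₁ = nᵢ d.
-- Since no prime factor of q divides every entry, the first column is coprime to d, and
-- q ∣ M v then forces d ∣ v₀.  A Bézout relation 1 = Σ uᵢ nᵢ + μ q′ reduces the remaining
-- conditions on v = (s d, v₁) to the single congruence v₁ ≡ -r s (mod q′), r = Σ uᵢ M i c₀;
-- conversely, q dividing all 2 × 2 minors makes every such vector satisfy q ∣ M v.
-- So Λ_q is spanned by the columns of [[d, 0], [-r, q′]], whose determinant is d q′ = q.

open import Defs
open import Data.Nat using (ℕ; _≤_)
open import Data.Nat.Primality using (Prime)
open import Data.Fin using (Fin; _<_; zero; suc)
open import Data.Integer using (ℤ; +_; ∣_∣)
open import Data.Integer.Divisibility using (_∣_)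
open import Data.Product using (Σ; _×_)
open import Relation.Nullary using (¬_)
open import Relation.Binary.PropositionalEquality using (_≡_; _≢_)
open import Function.Bundles using (_⇔_; mk⇔)

import Data.Nat as ℕ
import Data.Nat.Properties as ℕ
import Data.Nat.Divisibility as ℕ
import Data.Nat.GCD as ℕ
open import Data.Nat.GCD using (module Bézout)
open import Data.Nat.ListAction using (product)
open import Data.Nat.Primality.Factorisation using (factorise)
open import Data.Integer using (_+_; _*_; _-_; -_; 0ℤ; 1ℤ; -1ℤ; NonZero; ≢-nonZero)
open import Data.Integer.Properties as ℤ using (+-*-semiring)
open import Data.Integer.Divisibility.Signed as Signed using (divides; ∣m∣n⇒∣m+n; ∣n⇒∣m*n)
  renaming (_∣_ to _∣ₛ_)
open import Data.Integer.Tactic.RingSolver using (solve)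
open import Algebra.Properties.Semiring.Sum +-*-semiring
  using (sum; sum-syntax; ∑-distrib-+; *-distribˡ-sum; *-distribʳ-sum; sum-cong-≗)
open import Data.Vec.Functional using (Vector; tail)
open import Data.List using ([]; _∷_)
import Data.List.Relation.Unary.All as All
open import Data.Product using (_,_; ∃₂)
open import Data.Sum using (inj₁; inj₂)
open import Data.Empty using (⊥; ⊥-elim)
open import Data.Fin.Properties using (<-cmp)
open import Relation.Binary.Definitions using (tri<; tri≈; tri>)
open import Relation.Binary.PropositionalEquality
  using (refl; sym; trans; cong; cong₂; subst; subst₂; module ≡-Reasoning)
open ≡-Reasoning

∣-sum : ∀ {n d} (f : Vector ℤ n) → (∀ i → d ∣ₛ f i) → d ∣ₛ sum f
∣-sum {ℕ.zero}  {d} f d∣f = divides 0ℤ (sym (ℤ.*-zeroˡ d))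
∣-sum {ℕ.suc n}     f d∣f = ∣m∣n⇒∣m+n (d∣f zero) (∣-sum (tail f) (λ i → d∣f (suc i)))

∑-*-assoc : ∀ {n} (u x : Vector ℤ n) a → ∑[ i < n ] (u i * (x i * a)) ≡ (∑[ i < n ] (u i * x i)) * a
∑-*-assoc u x a = begin
  sum (λ i → u i * (x i * a)) ≡⟨ sum-cong-≗ (λ i → sym (ℤ.*-assoc (u i) (x i) a)) ⟩
  sum (λ i → u i * x i * a)   ≡⟨ *-distribʳ-sum a (λ i → u i * x i) ⟨
  sum (λ i → u i * x i) * a   ∎

+∣i∣≡±i : ∀ i → Σ ℤ λ s → + ∣ i ∣ ≡ s * i
+∣i∣≡±i i with ℤ.+∣i∣≡i⊎+∣i∣≡-i i
... | inj₁ eq = 1ℤ , trans eq (sym (ℤ.*-identityˡ i))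
... | inj₂ eq = -1ℤ , trans eq (sym (ℤ.-1*i≡-i i))

i+j≡k⇒i≡k-j : ∀ {i j k} → i + j ≡ k → i ≡ k - j
i+j≡k⇒i≡k-j {i} {j} {k} i+j≡k = begin
  i           ≡⟨ solve (i ∷ j ∷ []) ⟩
  i + j - j   ≡⟨ cong (_- j) i+j≡k ⟩
  k - j       ∎

ℕ-identity⇒ℤ-combination : ∀ {g} a b x y → g ℕ.+ b ℕ.* ∣ y ∣ ≡ a ℕ.* ∣ x ∣ →
                           ∃₂ λ α β → + g ≡ α * x + β * y
ℕ-identity⇒ℤ-combination {g} a b x y eq with +∣i∣≡±i x | +∣i∣≡±i y
... | s , ∣x∣≡sx | t , ∣y∣≡ty = + a * s , - (+ b * t) , (begin
  + g                             ≡⟨ i+j≡k⇒i≡k-j lifted ⟩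
  + a * + ∣ x ∣ - + b * + ∣ y ∣   ≡⟨ cong₂ (λ p r → + a * p - + b * r) ∣x∣≡sx ∣y∣≡ty ⟩
  + a * (s * x) - + b * (t * y)   ≡⟨ regroup (+ a) s x (+ b) t y ⟩
  + a * s * x + - (+ b * t) * y   ∎)
  where
  lifted : + g + + b * + ∣ y ∣ ≡ + a * + ∣ x ∣
  lifted = begin
    + g + + b * + ∣ y ∣     ≡⟨ cong (_+_ (+ g)) (ℤ.pos-* b ∣ y ∣) ⟨
    + (g ℕ.+ b ℕ.* ∣ y ∣)   ≡⟨ cong +_ eq ⟩
    + (a ℕ.* ∣ x ∣)         ≡⟨ ℤ.pos-* a ∣ x ∣ ⟩
    + a * + ∣ x ∣           ∎
  regroup : ∀ a s x b t y → a * (s * x) - b * (t * y) ≡ a * s * x + - (b * t) * y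
  regroup a s x b t y = solve (a ∷ s ∷ x ∷ b ∷ t ∷ y ∷ [])

bézout-identity : ∀ x y → ∃₂ λ α β → + ℕ.gcd ∣ x ∣ ∣ y ∣ ≡ α * x + β * y
bézout-identity x y with Bézout.identity (ℕ.gcd-GCD ∣ x ∣ ∣ y ∣)
... | Bézout.+- a b eq = ℕ-identity⇒ℤ-combination a b x y eq
... | Bézout.-+ a b eq with ℕ-identity⇒ℤ-combination b a y x eq
...   | β , α , g≡βy+αx = α , β , trans g≡βy+αx (ℤ.+-comm (β * y) (α * x))

bézout : ∀ x y → ∃₂ λ a b → (a * x + b * y) ∣ₛ x × (a * x + b * y) ∣ₛ y
bézout x y with bézout-identity x y
... | a , b , g≡ax+by = a , b , divide (ℕ.gcd[m,n]∣m ∣ x ∣ ∣ y ∣) , divide (ℕ.gcd[m,n]∣n ∣ x ∣ ∣ y ∣)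
  where
  divide : ∀ {z} → ℕ.gcd ∣ x ∣ ∣ y ∣ ℕ.∣ ∣ z ∣ → (a * x + b * y) ∣ₛ z
  divide g∣z = subst (_∣ₛ _) g≡ax+by (Signed.∣ᵤ⇒∣ g∣z)

record BézoutGcd {n} (xs : Vector ℤ n) (y : ℤ) : Set where
  field
    gcd             : ℤ
    coeffs          : Vector ℤ n
    coeffʸ          : ℤ
    gcd≡combination : gcd ≡ ∑[ i < n ] (coeffs i * xs i) + coeffʸ * y
    gcd∣xs          : ∀ i → gcd ∣ₛ xs i
    gcd∣y           : gcd ∣ₛ y

bézoutGcd : ∀ {n} (xs : Vector ℤ n) (y : ℤ) → BézoutGcd xs y
bézoutGcd {ℕ.zero} xs y = record
  { gcd = y ; coeffs = λ () ; coeffʸ = 1ℤ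
  ; gcd≡combination = sym (trans (ℤ.+-identityˡ (1ℤ * y)) (ℤ.*-identityˡ y))
  ; gcd∣xs = λ () ; gcd∣y = Signed.∣-refl
  }
bézoutGcd {ℕ.suc n} xs y with bézoutGcd (tail xs) y
... | G with bézout (xs zero) (BézoutGcd.gcd G)
... | a , b , g∣x₀ , g∣g′ = record
  { gcd = a * xs zero + b * g′ ; coeffs = coeffs ; coeffʸ = b * μ
  ; gcd≡combination = trans (cong (_+_ (a * xs zero)) b*g′≡) (sym (ℤ.+-assoc (a * xs zero) _ _))
  ; gcd∣xs = divides-xs ; gcd∣y = Signed.∣-trans g∣g′ gcd∣y
  }
  where
  open BézoutGcd G renaming (gcd to g′; coeffs to c; coeffʸ to μ)
  coeffs : Vector ℤ (ℕ.suc n)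
  coeffs zero    = a
  coeffs (suc i) = b * c i
  b*g′≡ : b * g′ ≡ ∑[ i < n ] (b * c i * xs (suc i)) + b * μ * y
  b*g′≡ = begin
    b * g′
      ≡⟨ cong (b *_) gcd≡combination ⟩
    b * (sum (λ i → c i * xs (suc i)) + μ * y)
      ≡⟨ ℤ.*-distribˡ-+ b _ (μ * y) ⟩
    b * sum (λ i → c i * xs (suc i)) + b * (μ * y)
      ≡⟨ cong₂ _+_ (*-distribˡ-sum b (λ i → c i * xs (suc i))) (sym (ℤ.*-assoc b μ y)) ⟩
    sum (λ i → b * (c i * xs (suc i))) + b * μ * y
      ≡⟨ cong (_+ b * μ * y) (sum-cong-≗ (λ i → sym (ℤ.*-assoc b (c i) (xs (suc i))))) ⟩
    sum (λ i → b * c i * xs (suc i)) + b * μ * y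
      ∎
  divides-xs : ∀ i → (a * xs zero + b * g′) ∣ₛ xs i
  divides-xs zero    = g∣x₀
  divides-xs (suc i) = Signed.∣-trans g∣g′ (gcd∣xs i)

no-prime-divisor⇒≡1 : ∀ {n} .{{_ : ℕ.NonZero n}} → (∀ {p} → Prime p → p ℕ.∣ n → ⊥) → n ≡ 1
no-prime-divisor⇒≡1 {n} no-prime with factorise n
... | record { factors = [] ; isFactorisation = n≡1 } = n≡1
... | record { factors = p ∷ ps ; isFactorisation = n≡p*Πps ; factorsPrime = p-prime All.∷ _ } =
  ⊥-elim (no-prime p-prime (ℕ.divides (product ps) (trans n≡p*Πps (ℕ.*-comm p (product ps)))))

∣unit*⇒∣ : ∀ {d u x} → ∣ u ∣ ≡ 1 → d ∣ₛ u * x → d ∣ₛ x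
∣unit*⇒∣ {d} {u} {x} ∣u∣≡1 d∣ux = Signed.∣ᵤ⇒∣ (subst (∣ d ∣ ℕ.∣_) ∣ux∣≡∣x∣ (Signed.∣⇒∣ᵤ d∣ux))
  where
  ∣ux∣≡∣x∣ : ∣ u * x ∣ ≡ ∣ x ∣
  ∣ux∣≡∣x∣ = trans (ℤ.abs-* u x) (trans (cong (ℕ._* ∣ x ∣) ∣u∣≡1) (ℕ.*-identityˡ ∣ x ∣))

coprime-divisor : ∀ {n} {xs : Vector ℤ n} {d v} (G : BézoutGcd xs d) → ∣ BézoutGcd.gcd G ∣ ≡ 1 →
                  (∀ i → d ∣ₛ xs i * v) → d ∣ₛ v
coprime-divisor {n} {xs} {d} {v} G unit d∣xsv =
  ∣unit*⇒∣ {u = BézoutGcd.gcd G} unit (subst (d ∣ₛ_) (sym gv≡) d∣combination)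
  where
  open BézoutGcd G
  gv≡ : gcd * v ≡ ∑[ i < n ] (coeffs i * (xs i * v)) + coeffʸ * v * d
  gv≡ = begin
    gcd * v
      ≡⟨ cong (_* v) gcd≡combination ⟩
    (sum (λ i → coeffs i * xs i) + coeffʸ * d) * v
      ≡⟨ ℤ.*-distribʳ-+ v (sum (λ i → coeffs i * xs i)) (coeffʸ * d) ⟩
    sum (λ i → coeffs i * xs i) * v + coeffʸ * d * v
      ≡⟨ cong₂ _+_ (∑-*-assoc coeffs xs v) (regroup coeffʸ d v) ⟨
    sum (λ i → coeffs i * (xs i * v)) + coeffʸ * v * d
      ∎
    where
    regroup : ∀ μ d v → μ * v * d ≡ μ * d * v
    regroup μ d v = solve (μ ∷ d ∷ v ∷ [])
  d∣combination : d ∣ₛ ∑[ i < n ] (coeffs i * (xs i * v)) + coeffʸ * v * d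
  d∣combination = ∣m∣n⇒∣m+n (∣-sum _ (λ i → ∣n⇒∣m*n (coeffs i) (d∣xsv i)))
                             (∣n⇒∣m*n (coeffʸ * v) Signed.∣-refl)

∣-unimodular-combination : ∀ {n} (ns us : Vector ℤ n) (μ q : ℤ) → 1ℤ ≡ ∑[ i < n ] (us i * ns i) + μ * q →
               ∀ a (bs : Vector ℤ n) → (∀ i → q ∣ₛ ns i * a + bs i) → q ∣ₛ a + ∑[ i < n ] (us i * bs i)
∣-unimodular-combination {n} ns us μ q one a bs q∣ = subst (q ∣ₛ_) (sym a+∑≡) q∣combination
  where
  a+∑≡ : a + sum (λ i → us i * bs i) ≡ sum (λ i → us i * (ns i * a + bs i)) + μ * a * q
  a+∑≡ = begin
    a + sum (λ i → us i * bs i)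
      ≡⟨ cong (_+ sum (λ i → us i * bs i)) (ℤ.*-identityˡ a) ⟨
    1ℤ * a + sum (λ i → us i * bs i)
      ≡⟨ cong (λ t → t * a + sum (λ i → us i * bs i)) one ⟩
    (sum (λ i → us i * ns i) + μ * q) * a + sum (λ i → us i * bs i)
      ≡⟨ regroup (sum (λ i → us i * ns i)) μ q a (sum (λ i → us i * bs i)) ⟩
    sum (λ i → us i * ns i) * a + sum (λ i → us i * bs i) + μ * a * q
      ≡⟨ cong (λ t → t + sum (λ i → us i * bs i) + μ * a * q) (∑-*-assoc us ns a) ⟨
    sum (λ i → us i * (ns i * a)) + sum (λ i → us i * bs i) + μ * a * q
      ≡⟨ cong (_+ μ * a * q) (∑-distrib-+ (λ i → us i * (ns i * a)) (λ i → us i * bs i)) ⟨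
    sum (λ i → us i * (ns i * a) + us i * bs i) + μ * a * q
      ≡⟨ cong (_+ μ * a * q) (sum-cong-≗ (λ i → ℤ.*-distribˡ-+ (us i) (ns i * a) (bs i))) ⟨
    sum (λ i → us i * (ns i * a + bs i)) + μ * a * q
      ∎
    where
    regroup : ∀ s μ q a t → (s + μ * q) * a + t ≡ s * a + t + μ * a * q
    regroup s μ q a t = solve (s ∷ μ ∷ q ∷ a ∷ t ∷ [])
  q∣combination : q ∣ₛ sum (λ i → us i * (ns i * a + bs i)) + μ * a * q
  q∣combination = ∣m∣n⇒∣m+n (∣-sum _ (λ i → ∣n⇒∣m*n (us i) (q∣ i))) (∣n⇒∣m*n (μ * a) Signed.∣-refl)

minor-self : ∀ {m} (M : Mat m 2) i → minor M i i ≡ 0ℤ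
minor-self M i = cancel (M i c₀) (M i c₁)
  where
  cancel : ∀ a b → a * b - b * a ≡ 0ℤ
  cancel a b = solve (a ∷ b ∷ [])

minor-antisym : ∀ {m} (M : Mat m 2) i j → minor M j i ≡ - minor M i j
minor-antisym M i j = swap (M i c₀) (M i c₁) (M j c₀) (M j c₁)
  where
  swap : ∀ a b c e → c * b - e * a ≡ - (a * e - b * c)
  swap a b c e = solve (a ∷ b ∷ c ∷ e ∷ [])

∣-minors : ∀ {m q} (M : Mat m 2) → (∀ i j → i < j → q ∣ minor M i j) → ∀ i j → q ∣ₛ minor M i j
∣-minors {q = q} M q∣minor< i j with <-cmp i j
... | tri< i<j _ _ = Signed.∣ᵤ⇒∣ (q∣minor< i j i<j)
... | tri≈ _ refl _ = subst (q ∣ₛ_) (sym (minor-self M i)) (Signed.∣ᵤ⇒∣ (ℕ._∣0 ∣ q ∣))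
... | tri> _ _ j<i =
  subst (q ∣ₛ_) (sym (minor-antisym M j i)) (Signed.∣m⇒∣-m (Signed.∣ᵤ⇒∣ (q∣minor< j i j<i)))

module LatticeBasis {m} (M : Mat m 2) (q : ℤ) (q≢0 : q ≢ 0ℤ)
  (q∣minor : ∀ i j → q ∣ₛ minor M i j)
  (no-common-prime : ∀ p → Prime p → (+ p) ∣ q → ¬ (∀ i k → (+ p) ∣ M i k)) where

  column : Fin 2 → Vector ℤ m
  column k i = M i k

  gcd₁ : BézoutGcd (column c₁) q
  gcd₁ = bézoutGcd (column c₁) q

  module G₁ = BézoutGcd gcd₁
  open G₁ using () renaming (gcd to d; coeffs to us; coeffʸ to μ)

  q′ : ℤ
  q′ = Signed._∣_.quotient G₁.gcd∣y

  q≡q′d : q ≡ q′ * d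
  q≡q′d = Signed._∣_.equality G₁.gcd∣y

  n : Vector ℤ m
  n i = Signed._∣_.quotient (G₁.gcd∣xs i)

  M₁≡nd : ∀ i → M i c₁ ≡ n i * d
  M₁≡nd i = Signed._∣_.equality (G₁.gcd∣xs i)

  d≢0 : d ≢ 0ℤ
  d≢0 d≡0 = q≢0 (trans q≡q′d (trans (cong (q′ *_) d≡0) (ℤ.*-zeroʳ q′)))

  instance
    d-nonZero : NonZero d
    d-nonZero = ≢-nonZero d≢0

  unimodular : 1ℤ ≡ ∑[ i < m ] (us i * n i) + μ * q′
  unimodular = ℤ.*-cancelʳ-≡ 1ℤ _ d (begin
    1ℤ * d                                          ≡⟨ ℤ.*-identityˡ d ⟩
    d                                               ≡⟨ G₁.gcd≡combination ⟩
    sum (λ i → us i * M i c₁) + μ * q               ≡⟨ cong₂ _+_ (sum-cong-≗ (λ i → cong (us i *_) (M₁≡nd i)))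
                                                                 (cong (μ *_) q≡q′d) ⟩
    sum (λ i → us i * (n i * d)) + μ * (q′ * d)     ≡⟨ cong₂ _+_ (∑-*-assoc us n d) (sym (ℤ.*-assoc μ q′ d)) ⟩
    sum (λ i → us i * n i) * d + μ * q′ * d         ≡⟨ ℤ.*-distribʳ-+ d (sum (λ i → us i * n i)) (μ * q′) ⟨
    (sum (λ i → us i * n i) + μ * q′) * d           ∎)

  gcd₀ : BézoutGcd (column c₀) d
  gcd₀ = bézoutGcd (column c₀) d

  module G₀ = BézoutGcd gcd₀

  gcd₀-unit : ∣ G₀.gcd ∣ ≡ 1
  gcd₀-unit = no-prime-divisor⇒≡1 {{ℕ.≢-nonZero ∣e∣≢0}} λ {p} p-prime p∣e →
    no-common-prime p p-prime (ℕ.∣-trans p∣e e∣q) (p∣M p∣e)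
    where
    e∣d : ∣ G₀.gcd ∣ ℕ.∣ ∣ d ∣
    e∣d = Signed.∣⇒∣ᵤ G₀.gcd∣y
    e∣q : ∣ G₀.gcd ∣ ℕ.∣ ∣ q ∣
    e∣q = ℕ.∣-trans e∣d (Signed.∣⇒∣ᵤ G₁.gcd∣y)
    ∣e∣≢0 : ∣ G₀.gcd ∣ ≢ 0
    ∣e∣≢0 ∣e∣≡0 = d≢0 (ℤ.∣i∣≡0⇒i≡0 (ℕ.0∣⇒≡0 (subst (ℕ._∣ ∣ d ∣) ∣e∣≡0 e∣d)))
    p∣M : ∀ {p} → p ℕ.∣ ∣ G₀.gcd ∣ → ∀ i k → (+ p) ∣ M i k
    p∣M p∣e i zero       = ℕ.∣-trans p∣e (Signed.∣⇒∣ᵤ (G₀.gcd∣xs i))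
    p∣M p∣e i (suc zero) = ℕ.∣-trans p∣e (ℕ.∣-trans e∣d (Signed.∣⇒∣ᵤ (G₁.gcd∣xs i)))

  d∣v₀ : ∀ v → InΛ M q v → d ∣ₛ v c₀
  d∣v₀ v v∈Λ = coprime-divisor gcd₀ gcd₀-unit d∣M₀v₀
    where
    d∣M₀v₀ : ∀ i → d ∣ₛ M i c₀ * v c₀
    d∣M₀v₀ i = Signed.∣m+n∣n⇒∣m (Signed.∣-trans G₁.gcd∣y (Signed.∣ᵤ⇒∣ (v∈Λ i)))
                                (Signed.∣m⇒∣m*n (v c₁) (G₁.gcd∣xs i))

  q∣⇒q′∣ : ∀ {x} → q ∣ₛ x * d → q′ ∣ₛ x
  q∣⇒q′∣ {x} q∣xd = Signed.*-cancelʳ-∣ d (subst (_∣ₛ x * d) q≡q′d q∣xd)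

  r : ℤ
  r = ∑[ i < m ] (us i * M i c₀)

  basis : Mat 2 2
  basis zero       zero       = d
  basis zero       (suc zero) = 0ℤ
  basis (suc zero) zero       = - r
  basis (suc zero) (suc zero) = q′

  Λ⊆span : ∀ v → InΛ M q v → InSpan basis v
  Λ⊆span v v∈Λ = w , v≡basis*w
    where
    s : ℤ
    s = Signed._∣_.quotient (d∣v₀ v v∈Λ)
    v₀≡sd : v c₀ ≡ s * d
    v₀≡sd = Signed._∣_.equality (d∣v₀ v v∈Λ)
    q′∣row : ∀ i → q′ ∣ₛ n i * v c₁ + M i c₀ * s
    q′∣row i = q∣⇒q′∣ (subst (q ∣ₛ_) Mvᵢ≡ (Signed.∣ᵤ⇒∣ (v∈Λ i)))
      where
      regroup : ∀ a s d n v₁ → a * (s * d) + n * d * v₁ ≡ (n * v₁ + a * s) * d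
      regroup a s d n v₁ = solve (a ∷ s ∷ d ∷ n ∷ v₁ ∷ [])
      Mvᵢ≡ : mulVec M v i ≡ (n i * v c₁ + M i c₀ * s) * d
      Mvᵢ≡ = trans (cong₂ (λ x y → M i c₀ * x + y * v c₁) v₀≡sd (M₁≡nd i))
                   (regroup (M i c₀) s d (n i) (v c₁))
    q′∣v₁+rs : q′ ∣ₛ v c₁ + r * s
    q′∣v₁+rs = subst (λ z → q′ ∣ₛ v c₁ + z) (∑-*-assoc us (λ i → M i c₀) s)
                     (∣-unimodular-combination n us μ q′ unimodular (v c₁) (λ i → M i c₀ * s) q′∣row)
    t : ℤ
    t = Signed._∣_.quotient q′∣v₁+rs
    w : Vec2
    w zero       = s
    w (suc zero) = t
    v≡basis*w : ∀ k → v k ≡ mulVec basis w k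
    v≡basis*w zero       = trans v₀≡sd (regroup s d t)
      where
      regroup : ∀ s d t → s * d ≡ d * s + 0ℤ * t
      regroup s d t = solve (s ∷ d ∷ t ∷ [])
    v≡basis*w (suc zero) = isolate (v c₁) r s t q′ (Signed._∣_.equality q′∣v₁+rs)
      where
      isolate : ∀ v₁ r s t q′ → v₁ + r * s ≡ t * q′ → v₁ ≡ - r * s + q′ * t
      isolate v₁ r s t q′ eq = begin
        v₁                   ≡⟨ solve (v₁ ∷ r ∷ s ∷ []) ⟩
        v₁ + r * s - r * s   ≡⟨ cong (_- r * s) eq ⟩
        t * q′ - r * s       ≡⟨ solve (t ∷ q′ ∷ r ∷ s ∷ []) ⟩
        - r * s + q′ * t     ∎

  span⊆Λ : ∀ v → InSpan basis v → InΛ M q v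
  span⊆Λ v (w , v≡basis*w) i =
    Signed.∣⇒∣ᵤ (subst₂ _∣ₛ_ (sym q≡q′d) (sym Mv≡) (Signed.*-monoˡ-∣ d q′∣X))
    where
    s t : ℤ
    s = w c₀
    t = w c₁
    q′∣minor : ∀ j → q′ ∣ₛ n j * M i c₀ + M j c₀ * - n i
    q′∣minor j = q∣⇒q′∣ (subst (q ∣ₛ_) minor≡ (q∣minor i j))
      where
      regroup : ∀ a b nᵢ nⱼ d → a * (nⱼ * d) - nᵢ * d * b ≡ (nⱼ * a + b * - nᵢ) * d
      regroup a b nᵢ nⱼ d = solve (a ∷ b ∷ nᵢ ∷ nⱼ ∷ d ∷ [])
      minor≡ : minor M i j ≡ (n j * M i c₀ + M j c₀ * - n i) * d
      minor≡ = trans (cong₂ (λ x y → M i c₀ * x - y * M j c₀) (M₁≡nd j) (M₁≡nd i))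
                     (regroup (M i c₀) (M j c₀) (n i) (n j) d)
    q′∣Mᵢ₀-rnᵢ : q′ ∣ₛ M i c₀ + r * - n i
    q′∣Mᵢ₀-rnᵢ = subst (λ z → q′ ∣ₛ M i c₀ + z) (∑-*-assoc us (λ j → M j c₀) (- n i))
                       (∣-unimodular-combination n us μ q′ unimodular
                                                 (M i c₀) (λ j → M j c₀ * - n i) q′∣minor)
    X : ℤ
    X = s * (M i c₀ + r * - n i) + n i * t * q′
    q′∣X : q′ ∣ₛ X
    q′∣X = ∣m∣n⇒∣m+n (∣n⇒∣m*n s q′∣Mᵢ₀-rnᵢ) (∣n⇒∣m*n (n i * t) Signed.∣-refl)
    Mv≡ : mulVec M v i ≡ X * d
    Mv≡ = trans (cong₂ (λ x y → M i c₀ * x + y) (v≡basis*w c₀) (cong₂ _*_ (M₁≡nd i) (v≡basis*w c₁)))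
                (regroup (M i c₀) d s t (n i) r q′)
      where
      regroup : ∀ a d s t n r q′ →
                a * (d * s + 0ℤ * t) + n * d * (- r * s + q′ * t) ≡ (s * (a + r * - n) + n * t * q′) * d
      regroup a d s t n r q′ = solve (a ∷ d ∷ s ∷ t ∷ n ∷ r ∷ q′ ∷ [])

  det-basis : det2 basis ≡ q
  det-basis = trans (regroup d q′ r) (sym q≡q′d)
    where
    regroup : ∀ d q′ r → d * q′ - 0ℤ * - r ≡ q′ * d
    regroup d q′ r = solve (d ∷ q′ ∷ r ∷ [])

mainTheorem2 : (m : ℕ) → 2 ≤ m → (M : Mat m 2) → (q : ℤ) → q ≢ + 0
    → (∀ (i j : Fin m) → i < j → q ∣ minor M i j)
    → (∀ (p : ℕ) → Prime p → (+ p) ∣ q → ¬ (∀ i k → (+ p) ∣ M i k))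
    → Σ (Mat 2 2) (λ B → (∀ (v : Vec2) → InΛ M q v ⇔ InSpan B v) × ∣ det2 B ∣ ≡ ∣ q ∣)
mainTheorem2 m _ M q q≢0 q∣minor< no-common-prime =
  basis , (λ v → mk⇔ (Λ⊆span v) (span⊆Λ v)) , cong ∣_∣ det-basis
  where
  open LatticeBasis M q q≢0 (∣-minors M q∣minor<) no-common-prime
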